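{- Let $G$ be a graph which does not satisfy condition $\star$. Let $x$ be a vertex of $G$ and let $H$ be obtained from $G$ by adding a new vertex $y$ whose neighborhood is either $N(y)=N(x)$ or $N(y)=N(x)\cup\{x\}$. Then $H$ does not satisfy condition $\star$.
   Context: For a vertex $a$, $N(a)$ is the set of neighbors of $a$ and $\overline{N(a)}=N(a)\cup\{a\}$. Condition $\star$: for every pair $a,b$ of distinct nonadjacent vertices there is a vertex $c$ with $N(a)\cup N(b)\subseteq\overline{N(c)}$. -}

module Defs where

open import Level using (0ℓ)
open import Data.Nat using (ℕ; suc)
open import Data.Fin using (Fin; inject₁; fromℕ)
open import Data.Product using (Σ; _×_; _,_)
open import Data.Sum using (_⊎_)
open import Relation.Nullary using (¬_)
open import Relation.Binary.PropositionalEquality using (_≡_; _≢_)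
open import Function.Bundles using (_⇔_)

record Graph (n : ℕ) : Set₁ where
  field
    Adj    : Fin n → Fin n → Set
    sym    : ∀ {a b} → Adj a b → Adj b a
    irrefl : ∀ {a} → ¬ Adj a a
open Graph public

_∈N[_]_ : ∀ {n} → Fin n → Graph n → Fin n → Set
c ∈N[ G ] a = Adj G a c

_∈N̄[_]_ : ∀ {n} → Fin n → Graph n → Fin n → Set
c ∈N̄[ G ] a = Adj G a c ⊎ c ≡ a

Star : ∀ {n} → Graph n → Set
Star {n} G = ∀ (a b : Fin n) → a ≢ b → ¬ Adj G a b →
  Σ (Fin n) λ c → ∀ (v : Fin n) → (v ∈N[ G ] a ⊎ v ∈N[ G ] b) → v ∈N̄[ G ] c

-- H (on Fin (suc n)) is obtained from G (on Fin n) by adding the new vertex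
-- y = fromℕ n: H restricted to the old vertices (via inject₁) is G.
Extends : ∀ {n} → Graph (suc n) → Graph n → Set
Extends {n} H G = ∀ (a b : Fin n) → Adj H (inject₁ a) (inject₁ b) ⇔ Adj G a b

NbhdCopy : ∀ {n} → Graph (suc n) → Graph n → Fin n → Set
NbhdCopy {n} H G x = ∀ (v : Fin n) → Adj H (fromℕ n) (inject₁ v) ⇔ Adj G x v

NbhdCopyPlus : ∀ {n} → Graph (suc n) → Graph n → Fin n → Set
NbhdCopyPlus {n} H G x = ∀ (v : Fin n) → Adj H (fromℕ n) (inject₁ v) ⇔ (Adj G x v ⊎ v ≡ x)

module Submission where

-- If H satisfies ⋆, then so does G: for nonadjacent a, b of G take the ⋆-witness c of a, b in H.
-- An old vertex c is a witness in G as well, and if c is the new vertex y then x is one,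
-- because every old neighbour of y lies in N̄(x).

open import Defs
open import Data.Nat using (ℕ; suc; zero)
open import Data.Fin using (Fin; zero; suc; inject₁; fromℕ)
open import Data.Fin.Properties using (inject₁-injective; fromℕ≢inject₁)
open import Data.Sum using (_⊎_; inj₁; inj₂; [_,_]′; map)
open import Data.Product using (_,_)
open import Data.Empty using (⊥-elim)
open import Relation.Nullary using (¬_)
open import Relation.Binary.PropositionalEquality using () renaming (sym to ≡-sym)
open import Function using (_∘_)
open import Function.Bundles using (Equivalence)
open Equivalence using (to; from)

data InjectOrLast {n : ℕ} : Fin (suc n) → Set where
  inject : (i : Fin n) → InjectOrLast (inject₁ i)
  last   : InjectOrLast (fromℕ n)

injectOrLast : ∀ {n} (j : Fin (suc n)) → InjectOrLast j
injectOrLast {zero}  zero    = last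
injectOrLast {suc n} zero    = inject zero
injectOrLast {suc n} (suc j) with injectOrLast j
... | inject i = inject (suc i)
... | last     = last

NbhdWithinClosed : ∀ {n} → Graph (suc n) → Graph n → Fin n → Set
NbhdWithinClosed {n} H G x = ∀ (v : Fin n) → Adj H (fromℕ n) (inject₁ v) → v ∈N̄[ G ] x

nbhdCopy⇒withinClosed : ∀ {n} (H : Graph (suc n)) (G : Graph n) (x : Fin n) →
  NbhdCopy H G x → NbhdWithinClosed H G x
nbhdCopy⇒withinClosed H G x copy v = inj₁ ∘ to (copy v)

nbhdCopyPlus⇒withinClosed : ∀ {n} (H : Graph (suc n)) (G : Graph n) (x : Fin n) →
  NbhdCopyPlus H G x → NbhdWithinClosed H G x
nbhdCopyPlus⇒withinClosed H G x copy v = to (copy v)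

module _ {n} (H : Graph (suc n)) (G : Graph n) (ext : Extends H G) where

  ∈N-inject₁ : ∀ {a v} → v ∈N[ G ] a → inject₁ v ∈N[ H ] inject₁ a
  ∈N-inject₁ {a} {v} = from (ext a v)

  ∈N̄-inject₁⁻ : ∀ {c v} → inject₁ v ∈N̄[ H ] inject₁ c → v ∈N̄[ G ] c
  ∈N̄-inject₁⁻ {c} {v} = [ inj₁ ∘ to (ext c v) , inj₂ ∘ inject₁-injective ]′

  ∈N̄-last⁻ : ∀ {x v} → NbhdWithinClosed H G x → inject₁ v ∈N̄[ H ] fromℕ n → v ∈N̄[ G ] x
  ∈N̄-last⁻ {v = v} within = [ within v , ⊥-elim ∘ fromℕ≢inject₁ ∘ ≡-sym ]′

  star-restrict : ∀ {x} → NbhdWithinClosed H G x → Star H → Star G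
  star-restrict {x} within starH a b a≢b a≁b
    with starH (inject₁ a) (inject₁ b) (a≢b ∘ inject₁-injective) (a≁b ∘ to (ext a b))
  ... | c , covers with injectOrLast c
  ...   | inject c′ = c′ , λ v → ∈N̄-inject₁⁻ ∘ covers (inject₁ v) ∘ map ∈N-inject₁ ∈N-inject₁
  ...   | last      = x  , λ v → ∈N̄-last⁻ within ∘ covers (inject₁ v) ∘ map ∈N-inject₁ ∈N-inject₁

mainTheorem14 : ∀ {n : ℕ} (G : Graph n) (H : Graph (suc n)) (x : Fin n) →
    ¬ Star G → Extends H G → (NbhdCopy H G x ⊎ NbhdCopyPlus H G x) → ¬ Star H
mainTheorem14 G H x ¬starG ext copy = ¬starG ∘ star-restrict H G ext within
  where
  within : NbhdWithinClosed H G x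
  within = [ nbhdCopy⇒withinClosed H G x , nbhdCopyPlus⇒withinClosed H G x ]′ copy
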